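{- Let $(\mathcal C,\otimes,I,\gamma)$ be a symmetric monoidal category and $\mathcal T$ a strong monad on it. If $(Z,\iota)$ is a terminal central cone of $\mathcal T$ at an object $X$, then $\iota$ is a monomorphism.
   Context: $\mathcal T=(\mathcal T,\eta,\mu,\tau)$ with left strength $\tau_{X,Y}:X\otimes\mathcal TY\to\mathcal T(X\otimes Y)$ and right strength $\tau'_{X,Y}=\mathcal T(\gamma_{Y,X})\circ\tau_{Y,X}\circ\gamma_{\mathcal TX,Y}$. A central cone of $\mathcal T$ at $X$ is a pair $(W,\iota)$ with $\iota:W\to\mathcal TX$ such that for every object $Y$, $\mu\circ\mathcal T\tau'_{X,Y}\circ\tau_{\mathcal TX,Y}\circ(\iota\otimes\mathcal TY)=\mu\circ\mathcal T\tau_{X,Y}\circ\tau'_{X,\mathcal TY}\circ(\iota\otimes\mathcal TY):W\otimes\mathcal TY\to\mathcal T(X\otimes Y)$. A morphism of central cones $(W',\iota')\to(W,\iota)$ is $\varphi:W'\to W$ with $\iota\circ\varphi=\iota'$; a terminal central cone is a terminal object of the category of central cones at $X$. -}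

module Defs where

open import Level using (Level; _⊔_; suc)
open import Relation.Binary using (IsEquivalence)

record Category (o ℓ e : Level) : Set (suc (o ⊔ ℓ ⊔ e)) where
  infix  4 _≈_
  infixr 9 _∘_
  field
    Obj : Set o
    _⇒_ : Obj → Obj → Set ℓ
    _≈_ : ∀ {A B} → (A ⇒ B) → (A ⇒ B) → Set e
    id  : ∀ {A} → A ⇒ A
    _∘_ : ∀ {A B C} → (B ⇒ C) → (A ⇒ B) → (A ⇒ C)
    ≈-equiv : ∀ {A B} → IsEquivalence (_≈_ {A} {B})
    ∘-resp-≈ : ∀ {A B C} {f h : B ⇒ C} {g i : A ⇒ B} → f ≈ h → g ≈ i → f ∘ g ≈ h ∘ i
    assoc : ∀ {A B C D} {f : A ⇒ B} {g : B ⇒ C} {h : C ⇒ D} → (h ∘ g) ∘ f ≈ h ∘ (g ∘ f)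
    identityˡ : ∀ {A B} {f : A ⇒ B} → id ∘ f ≈ f
    identityʳ : ∀ {A B} {f : A ⇒ B} → f ∘ id ≈ f

module _ {o ℓ e} (C : Category o ℓ e) where
  open Category C

  IsMono : ∀ {A B} → A ⇒ B → Set (o ⊔ ℓ ⊔ e)
  IsMono {A} f = ∀ {W} (g h : W ⇒ A) → f ∘ g ≈ f ∘ h → g ≈ h

record SymmetricMonoidal {o ℓ e} (C : Category o ℓ e) : Set (o ⊔ ℓ ⊔ e) where
  open Category C
  infixr 10 _⊗₀_ _⊗₁_
  field
    _⊗₀_ : Obj → Obj → Obj
    _⊗₁_ : ∀ {A B C D} → A ⇒ B → C ⇒ D → (A ⊗₀ C) ⇒ (B ⊗₀ D)
    ⊗-identity : ∀ {A B} → id {A} ⊗₁ id {B} ≈ id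
    ⊗-homomorphism : ∀ {A B C D E F} {f : A ⇒ B} {g : B ⇒ C} {h : D ⇒ E} {i : E ⇒ F}
                   → (g ∘ f) ⊗₁ (i ∘ h) ≈ (g ⊗₁ i) ∘ (f ⊗₁ h)
    ⊗-resp-≈ : ∀ {A B C D} {f g : A ⇒ B} {h i : C ⇒ D} → f ≈ g → h ≈ i → f ⊗₁ h ≈ g ⊗₁ i
    unit : Obj
    α⇒ : ∀ {A B C} → ((A ⊗₀ B) ⊗₀ C) ⇒ (A ⊗₀ (B ⊗₀ C))
    α⇐ : ∀ {A B C} → (A ⊗₀ (B ⊗₀ C)) ⇒ ((A ⊗₀ B) ⊗₀ C)
    α-isoˡ : ∀ {A B C} → α⇐ ∘ α⇒ {A} {B} {C} ≈ id
    α-isoʳ : ∀ {A B C} → α⇒ ∘ α⇐ {A} {B} {C} ≈ id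
    α-natural : ∀ {A B C D E F} {f : A ⇒ D} {g : B ⇒ E} {h : C ⇒ F}
              → α⇒ ∘ ((f ⊗₁ g) ⊗₁ h) ≈ (f ⊗₁ (g ⊗₁ h)) ∘ α⇒
    λ⇒ : ∀ {A} → (unit ⊗₀ A) ⇒ A
    λ⇐ : ∀ {A} → A ⇒ (unit ⊗₀ A)
    λ-isoˡ : ∀ {A} → λ⇐ ∘ λ⇒ {A} ≈ id
    λ-isoʳ : ∀ {A} → λ⇒ ∘ λ⇐ {A} ≈ id
    λ-natural : ∀ {A B} {f : A ⇒ B} → λ⇒ ∘ (id ⊗₁ f) ≈ f ∘ λ⇒
    ρ⇒ : ∀ {A} → (A ⊗₀ unit) ⇒ A
    ρ⇐ : ∀ {A} → A ⇒ (A ⊗₀ unit)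
    ρ-isoˡ : ∀ {A} → ρ⇐ ∘ ρ⇒ {A} ≈ id
    ρ-isoʳ : ∀ {A} → ρ⇒ ∘ ρ⇐ {A} ≈ id
    ρ-natural : ∀ {A B} {f : A ⇒ B} → ρ⇒ ∘ (f ⊗₁ id) ≈ f ∘ ρ⇒
    triangle : ∀ {A B} → (id {A} ⊗₁ λ⇒ {B}) ∘ α⇒ ≈ ρ⇒ ⊗₁ id
    pentagon : ∀ {A B C D}
             → (id {A} ⊗₁ α⇒ {B} {C} {D}) ∘ α⇒ ∘ (α⇒ ⊗₁ id) ≈ α⇒ ∘ α⇒
    γ : ∀ {A B} → (A ⊗₀ B) ⇒ (B ⊗₀ A)
    γ-natural : ∀ {A B C D} {f : A ⇒ B} {g : C ⇒ D} → γ ∘ (f ⊗₁ g) ≈ (g ⊗₁ f) ∘ γ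
    γ-involutive : ∀ {A B} → γ {B} {A} ∘ γ {A} {B} ≈ id
    hexagon : ∀ {A B C}
            → (id {B} ⊗₁ γ {A} {C}) ∘ α⇒ ∘ (γ ⊗₁ id) ≈ α⇒ ∘ γ {A} {B ⊗₀ C} ∘ α⇒

record StrongMonad {o ℓ e} {C : Category o ℓ e} (M : SymmetricMonoidal C) : Set (o ⊔ ℓ ⊔ e) where
  open Category C
  open SymmetricMonoidal M
  field
    T₀ : Obj → Obj
    T₁ : ∀ {A B} → A ⇒ B → T₀ A ⇒ T₀ B
    T-identity : ∀ {A} → T₁ (id {A}) ≈ id
    T-homomorphism : ∀ {A B D} {f : A ⇒ B} {g : B ⇒ D} → T₁ (g ∘ f) ≈ T₁ g ∘ T₁ f
    T-resp-≈ : ∀ {A B} {f g : A ⇒ B} → f ≈ g → T₁ f ≈ T₁ g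
    η : ∀ {A} → A ⇒ T₀ A
    μ : ∀ {A} → T₀ (T₀ A) ⇒ T₀ A
    η-natural : ∀ {A B} {f : A ⇒ B} → η ∘ f ≈ T₁ f ∘ η
    μ-natural : ∀ {A B} {f : A ⇒ B} → μ ∘ T₁ (T₁ f) ≈ T₁ f ∘ μ
    μ-assoc : ∀ {A} → μ {A} ∘ T₁ μ ≈ μ ∘ μ
    μ-identityˡ : ∀ {A} → μ {A} ∘ T₁ η ≈ id
    μ-identityʳ : ∀ {A} → μ {A} ∘ η ≈ id
    τ : ∀ {A B} → (A ⊗₀ T₀ B) ⇒ T₀ (A ⊗₀ B)
    τ-natural : ∀ {A B D E} {f : A ⇒ D} {g : B ⇒ E}
              → τ ∘ (f ⊗₁ T₁ g) ≈ T₁ (f ⊗₁ g) ∘ τ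
    τ-unit : ∀ {A} → T₁ λ⇒ ∘ τ {unit} {A} ≈ λ⇒
    τ-assoc : ∀ {A B D}
            → τ ∘ (id {A} ⊗₁ τ {B} {D}) ∘ α⇒ ≈ T₁ α⇒ ∘ τ
    τ-η : ∀ {A B} → τ ∘ (id {A} ⊗₁ η {B}) ≈ η
    τ-μ : ∀ {A B} → τ ∘ (id {A} ⊗₁ μ {B}) ≈ μ ∘ T₁ τ ∘ τ

  τ′ : ∀ {A B} → (T₀ A ⊗₀ B) ⇒ T₀ (A ⊗₀ B)
  τ′ {A} {B} = T₁ (γ {B} {A}) ∘ τ {B} {A} ∘ γ {T₀ A} {B}

module _ {o ℓ e} {C : Category o ℓ e} {M : SymmetricMonoidal C} (S : StrongMonad M) where
  open Category C
  open SymmetricMonoidal M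
  open StrongMonad S

  record CentralCone (X : Obj) : Set (o ⊔ ℓ ⊔ e) where
    field
      W : Obj
      ι : W ⇒ T₀ X
      central : ∀ Y →
        μ ∘ T₁ (τ′ {X} {Y}) ∘ τ {T₀ X} {Y} ∘ (ι ⊗₁ id {T₀ Y})
          ≈ μ ∘ T₁ (τ {X} {Y}) ∘ τ′ {X} {T₀ Y} ∘ (ι ⊗₁ id {T₀ Y})

  record ConeMorphism {X : Obj} (c′ c : CentralCone X) : Set (ℓ ⊔ e) where
    open CentralCone
    field
      φ : W c′ ⇒ W c
      commutes : ι c ∘ φ ≈ ι c′

  record IsTerminalCentralCone {X : Obj} (c : CentralCone X) : Set (o ⊔ ℓ ⊔ e) where
    field
      ! : (c′ : CentralCone X) → ConeMorphism c′ c
      !-unique : (c′ : CentralCone X) (f : ConeMorphism c′ c)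
               → ConeMorphism.φ f ≈ ConeMorphism.φ (! c′)

{-# OPTIONS --safe #-}
module Submission where

-- Precomposing a central cone with any arrow again gives a central cone. If ι ∘ g ≈ ι ∘ h,
-- then g and h are both cone morphisms from (V , ι ∘ g) into the terminal cone, hence equal.

open import Relation.Binary using (Setoid; IsEquivalence)
import Relation.Binary.Reasoning.Setoid as SetoidReasoning
open import Defs

module CategoryProperties {o ℓ e} (C : Category o ℓ e) where
  open Category C public
  module ≈ {A B} = IsEquivalence (≈-equiv {A} {B})

  hom-setoid : Obj → Obj → Setoid ℓ e
  hom-setoid A B = record { isEquivalence = ≈-equiv {A} {B} }

  module HomReasoning {A B} = SetoidReasoning (hom-setoid A B)

  assoc-last : ∀ {A B D E F G} {a : F ⇒ G} {b : E ⇒ F} {c : D ⇒ E} {d : B ⇒ D} {f : A ⇒ B}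
             → a ∘ b ∘ c ∘ (d ∘ f) ≈ (a ∘ b ∘ c ∘ d) ∘ f
  assoc-last = ≈.sym (≈.trans assoc (∘-resp-≈ ≈.refl (≈.trans assoc (∘-resp-≈ ≈.refl assoc))))

module MonoidalProperties {o ℓ e} {C : Category o ℓ e} (M : SymmetricMonoidal C) where
  open CategoryProperties C
  open SymmetricMonoidal M public

  ⊗-id-distribʳ : ∀ {A B D E} {f : B ⇒ D} {g : A ⇒ B}
                → (f ∘ g) ⊗₁ id {E} ≈ (f ⊗₁ id) ∘ (g ⊗₁ id)
  ⊗-id-distribʳ = ≈.trans (⊗-resp-≈ ≈.refl (≈.sym identityˡ)) ⊗-homomorphism

module CentralConeProperties {o ℓ e} {C : Category o ℓ e} {M : SymmetricMonoidal C}
                             (S : StrongMonad M) where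
  open CategoryProperties C
  open MonoidalProperties M
  open StrongMonad S
  open CentralCone
  open ConeMorphism

  restrict : ∀ {X V} (c : CentralCone S X) → V ⇒ W c → CentralCone S X
  restrict {X} {V} c f = record { W = V ; ι = ι c ∘ f ; central = central-∘ }
    where
    open HomReasoning
    central-∘ : ∀ Y →
      μ ∘ T₁ (τ′ {X} {Y}) ∘ τ {T₀ X} {Y} ∘ ((ι c ∘ f) ⊗₁ id {T₀ Y})
        ≈ μ ∘ T₁ (τ {X} {Y}) ∘ τ′ {X} {T₀ Y} ∘ ((ι c ∘ f) ⊗₁ id {T₀ Y})
    central-∘ Y = begin
      μ ∘ T₁ τ′ ∘ τ ∘ ((ι c ∘ f) ⊗₁ id)          ≈⟨ ∘-resp-≈ ≈.refl (∘-resp-≈ ≈.refl (∘-resp-≈ ≈.refl ⊗-id-distribʳ)) ⟩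
      μ ∘ T₁ τ′ ∘ τ ∘ ((ι c ⊗₁ id) ∘ (f ⊗₁ id))  ≈⟨ assoc-last ⟩
      (μ ∘ T₁ τ′ ∘ τ ∘ (ι c ⊗₁ id)) ∘ (f ⊗₁ id)  ≈⟨ ∘-resp-≈ (central c Y) ≈.refl ⟩
      (μ ∘ T₁ τ ∘ τ′ ∘ (ι c ⊗₁ id)) ∘ (f ⊗₁ id)  ≈⟨ assoc-last ⟨
      μ ∘ T₁ τ ∘ τ′ ∘ ((ι c ⊗₁ id) ∘ (f ⊗₁ id))  ≈⟨ ∘-resp-≈ ≈.refl (∘-resp-≈ ≈.refl (∘-resp-≈ ≈.refl ⊗-id-distribʳ)) ⟨
      μ ∘ T₁ τ ∘ τ′ ∘ ((ι c ∘ f) ⊗₁ id)          ∎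

  restrict-morphism : ∀ {X V} (c : CentralCone S X) {f g : V ⇒ W c}
                    → ι c ∘ g ≈ ι c ∘ f → ConeMorphism S (restrict c f) c
  restrict-morphism c {g = g} ιg≈ιf = record { φ = g ; commutes = ιg≈ιf }

  terminal-morphism-unique : ∀ {X} {c c′ : CentralCone S X} → IsTerminalCentralCone S c
                           → (f g : ConeMorphism S c′ c) → φ f ≈ φ g
  terminal-morphism-unique {c′ = c′} terminal f g =
    ≈.trans (!-unique c′ f) (≈.sym (!-unique c′ g))
    where open IsTerminalCentralCone terminal

lemma2p9 : ∀ {o ℓ e} {C : Category o ℓ e} {M : SymmetricMonoidal C}
             (S : StrongMonad M) {X : Category.Obj C}
             (c : CentralCone S X) → IsTerminalCentralCone S c
             → IsMono C (CentralCone.ι c)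
lemma2p9 {C = C} S c terminal g h ιg≈ιh =
  terminal-morphism-unique terminal
    (restrict-morphism c ≈.refl)
    (restrict-morphism c (≈.sym ιg≈ιh))
  where
  open CategoryProperties C using (module ≈)
  open CentralConeProperties S
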